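{- Let $q$ be a prime power, $k\ge 2$ and $r\ge 1$ integers. Then there exists an integer $D$ (depending on $q$, $k$, $r$) such that for all integers $d\ge D$ we have $n_q(k,d,r)=g_q(k,d)$.
   Context: An $[n,k,d]_q$-code is a $k$-dimensional subspace of $\mathbb{F}_q^n$ with minimum Hamming distance at least $d$. A linear code $C\subseteq\mathbb{F}_q^n$ has locality $r$ if for every coordinate $i\in\{1,\dots,n\}$ there is a set $S_i\subseteq\{1,\dots,n\}$ with $i\notin S_i$, $|S_i|\le r$, such that any two codewords $c,c'\in C$ with $c_j=c'_j$ for all $j\in S_i$ satisfy $c_i=c'_i$. $n_q(k,d,r)$ denotes the minimum length $n$ of an $[n,k,d]_q$-code with locality $r$. $g_q(k,d)=\sum_{i=0}^{k-1}\lceil d/q^i\rceil$ is the Griesmer bound. -}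

module Defs where

open import Level using (0ℓ)
open import Data.Nat using (ℕ; zero; suc; _+_; _^_; _≤_; _/_)
open import Data.Nat.Primality using (Prime)
open import Data.Fin using (Fin; zero; suc)
open import Data.Fin.Subset using (Subset; _∈_; _∉_; ∣_∣)
open import Data.Product using (Σ; ∃; ∃-syntax; _×_)
open import Relation.Binary.PropositionalEquality using (_≡_)
open import Relation.Binary.Definitions using (Decidable)
open import Relation.Nullary using (¬_; yes; no)
open import Algebra.Bundles using (CommutativeRing)

IsPrimePower : ℕ → Set
IsPrimePower q = ∃[ p ] ∃[ m ] (Prime p × q ≡ p ^ suc m)

-- The carrier is a setoid (stdlib convention); equality is decidable and
-- the carrier is in bijection (up to ≈) with Fin q.
record FiniteField (q : ℕ) : Set₁ where
  field
    commRing : CommutativeRing 0ℓ 0ℓ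
  open CommutativeRing commRing public
  field
    1≉0     : ¬ (1# ≈ 0#)
    inverse : ∀ x → ¬ (x ≈ 0#) → ∃[ y ] (x * y ≈ 1#)
    _≟_     : Decidable _≈_
    enum    : Fin q → Carrier
    enum-surj : ∀ x → ∃[ i ] (enum i ≈ x)
    enum-inj  : ∀ i j → enum i ≈ enum j → i ≡ j

-- ceiling division ⌈ m / n ⌉ (junk value 0 for n = 0, never used)
⌈_/_⌉ : ℕ → ℕ → ℕ
⌈ m / zero ⌉  = 0
⌈ m / suc n ⌉ = (m + n) / suc n

-- Griesmer bound g_q(k,d) = Σ_{i=0}^{k-1} ⌈ d / q^i ⌉
griesmerFrom : ℕ → ℕ → ℕ → ℕ → ℕ
griesmerFrom q zero    i d = 0
griesmerFrom q (suc k) i d = ⌈ d / q ^ i ⌉ + griesmerFrom q k (suc i) d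

griesmer : ℕ → ℕ → ℕ → ℕ
griesmer q k d = griesmerFrom q k 0 d

module Codes {q : ℕ} (F : FiniteField q) where
  open FiniteField F using (Carrier; _≈_; 0#; _≟_)
    renaming (_+_ to _+F_; _*_ to _*F_)

  ∑ : ∀ {k} → (Fin k → Carrier) → Carrier
  ∑ {zero}  f = 0#
  ∑ {suc k} f = f zero +F ∑ (λ i → f (suc i))

  hamming : ∀ {n} → (Fin n → Carrier) → (Fin n → Carrier) → ℕ
  hamming {zero}  c c' = 0
  hamming {suc n} c c' with c zero ≟ c' zero
  ... | yes _ = hamming (λ j → c (suc j)) (λ j → c' (suc j))
  ... | no  _ = suc (hamming (λ j → c (suc j)) (λ j → c' (suc j)))

  -- A linear code of length n and dimension k is given by a generator
  -- matrix G (k × n, full row rank); its codewords are the words x·G.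
  GenMatrix : ℕ → ℕ → Set
  GenMatrix k n = Fin k → Fin n → Carrier

  encode : ∀ {k n} → GenMatrix k n → (Fin k → Carrier) → Fin n → Carrier
  encode G x j = ∑ (λ i → x i *F G i j)

  FullRank : ∀ {k n} → GenMatrix k n → Set
  FullRank G = ∀ x → (∀ j → encode G x j ≈ 0#) → ∀ i → x i ≈ 0#

  MinDist≥ : ∀ {k n} → GenMatrix k n → ℕ → Set
  MinDist≥ G d = ∀ x y → ¬ (∀ j → encode G x j ≈ encode G y j)
                 → d ≤ hamming (encode G x) (encode G y)

  Locality : ∀ {k n} → GenMatrix k n → ℕ → Set
  Locality {n = n} G r = ∀ (i : Fin n) → Σ (Subset n) λ S →
      i ∉ S × ∣ S ∣ ≤ r ×
      (∀ x y → (∀ j → j ∈ S → encode G x j ≈ encode G y j)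
             → encode G x i ≈ encode G y i)

  IsLRC : ∀ {k n} → GenMatrix k n → ℕ → ℕ → Set
  IsLRC G d r = FullRank G × MinDist≥ G d × Locality G r

  nq≡ : ℕ → ℕ → ℕ → ℕ → Set
  nq≡ k d r m = (Σ (GenMatrix k m) λ G → IsLRC G d r)
              × (∀ n (G : GenMatrix k n) → IsLRC G d r → m ≤ n)

-- Lower bound. Let x₀ be a nonzero message of
-- minimum weight w ≥ d and i₀ a coordinate with x₀ᵢ₀ ≠ 0. For a nonzero message x with xᵢ₀ = 0,
-- the q messages x + e·x₀ (e ∈ F_q) are nonzero, and summing their weights counts each column v
-- with x₀·v ≠ 0 exactly q − 1 times and every other column q·[x·v ≠ 0] times; so
-- q·w ≤ q·wt′(x) + (q − 1)·w. Hence the residual code (the columns orthogonal to x₀, with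
-- coordinate i₀ deleted) has dimension k − 1, length n − w and minimum distance ⌈w/q⌉, and
-- induction gives n ≥ w + g_q(k − 1, ⌈w/q⌉) ≥ g_q(k, d).
--
-- Upper bound. Take s = ⌈d/q^(k−1)⌉ copies of the q^(k−1) affine points (1, v), and at infinity,
-- as columns (0, v), recursively a code of dimension k − 1 for the distance d − s(q − 1)q^(k−2).
-- A message with x₂ = … = x_k = 0 is nonzero on all s·q^(k−1) ≥ d affine columns; any other one is
-- nonzero on exactly (q − 1)q^(k−2) affine points and, by induction, on at least
-- d − s(q − 1)q^(k−2) columns at infinity. The length s·q^(k−1) + g_q(k − 1, ·) telescopes to
-- g_q(k, d). For d ≥ (2 + (k − 1)q)·q^(k−1) every level of the recursion has s ≥ 2, so every column
-- occurs twice and each coordinate is repaired from its copy: the code has locality 1 ≤ r.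

module Submission where

open import Defs
import Data.Nat.Properties as ℕ
open import Algebra.Properties.CommutativeMonoid.Sum ℕ.+-0-commutativeMonoid using (sum; sum-remove; sum-cong-≗)
  renaming (∑-distrib-+ to sum-distrib-+)
import Algebra.Properties.CommutativeSemigroup as CommutativeSemigroupProperties
import Algebra.Properties.Group as GroupProperties
import Algebra.Properties.Ring as RingProperties
open import Data.Fin using (Fin; zero; suc; punchIn; toℕ)
import Data.Fin as Fin
open import Data.Fin.Properties using (punchInᵢ≢i; all?; ¬∀⟶∃¬; toℕ<n)
open import Data.Fin.Subset using (⁅_⁆)
open import Data.Fin.Subset.Properties using (x∈⁅x⁆; x∈⁅y⁆⇒x≡y; ∣⁅x⁆∣≡1)
open import Data.List using (List; []; _∷_; _++_; map; length; filter; concat; replicate; lookup)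
open import Data.List.Extrema ℕ.≤-totalOrder using (argmin; argmin-all; f[argmin]≤f[xs])
open import Data.List.Membership.Propositional using (_∈_)
open import Data.List.Membership.Propositional.Properties
  using (∈-++⁺ˡ; ∈-++⁺ʳ; ∈-++⁻; ∈-map⁺; ∈-filter⁺; ∈-lookup)
open import Data.List.Properties using (map-++; map-∘; map-cong; length-map)
open import Data.List.Relation.Binary.Subset.Propositional using (_⊆_)
import Data.List.Relation.Binary.Subset.Propositional.Properties as ⊆
import Data.List.Relation.Unary.All as All
open import Data.List.Relation.Unary.All.Properties using (all-filter)
open import Data.List.Relation.Unary.Any using (here; there; index)
open import Data.List.Relation.Unary.Any.Properties using (lookup-index)
open import Data.Nat
  using (ℕ; zero; suc; _+_; _*_; _∸_; _^_; _≤_; _<_; z≤n; s≤s; z<s; pred; NonZero; >-nonZero; >-nonZero⁻¹)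
open import Data.Nat.DivMod using (_/_; _%_; m≡m%n+[m/n]*n; m%n<n; m<n*o⇒m/o<n; n/1≡n; +-distrib-/-∣ʳ; m*n/n≡m)
open import Data.Nat.Divisibility using (divides)
open import Data.Nat.ListAction using () renaming (sum to sumₗ)
open import Data.Nat.ListAction.Properties using () renaming (sum-++ to sumₗ-++)
open import Data.Nat.Tactic.RingSolver using (solve-∀)
open import Data.Product using (Σ; ∃; ∃-syntax; _×_; _,_)
open import Data.Sum using (inj₁; inj₂; [_,_]′)
open import Data.Vec.Functional using (Vector; insertAt; removeAt)
import Data.Vec.Functional as V
open import Data.Vec.Functional.Properties using (insertAt-lookup; insertAt-punchIn)
open import Function using (_∘_; id)
open import Relation.Nullary using (¬_; Dec; yes; no; ¬?; contradiction)
open import Relation.Binary.PropositionalEquality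
  using (_≡_; _≢_; refl; sym; trans; cong; cong₂; subst; module ≡-Reasoning)
import Relation.Binary.Reasoning.Setoid as SetoidReasoning

⌈/⌉≤⇒≤* : ∀ {b} → 0 < b → ∀ m t → ⌈ m / b ⌉ ≤ t → m ≤ b * t
⌈/⌉≤⇒≤* {suc n} _ m t ⌈m/b⌉≤t = ℕ.+-cancelʳ-≤ n m (suc n * t) (begin
  m + n                                     ≡⟨ m≡m%n+[m/n]*n (m + n) (suc n) ⟩
  (m + n) % suc n + (m + n) / suc n * suc n ≤⟨ ℕ.+-mono-≤ (ℕ.≤-pred (m%n<n (m + n) (suc n)))
                                                           (ℕ.*-monoˡ-≤ (suc n) ⌈m/b⌉≤t) ⟩
  n + t * suc n                             ≡⟨ rearrange n t ⟩
  suc n * t + n                             ∎)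
  where
  open ℕ.≤-Reasoning
  rearrange : ∀ n t → n + t * suc n ≡ suc n * t + n
  rearrange = solve-∀

≤*⇒⌈/⌉≤ : ∀ {b} → 0 < b → ∀ m t → m ≤ b * t → ⌈ m / b ⌉ ≤ t
≤*⇒⌈/⌉≤ {suc n} _ m t m≤bt = ℕ.≤-pred (m<n*o⇒m/o<n (begin-strict
  m + n          ≤⟨ ℕ.+-monoˡ-≤ n m≤bt ⟩
  suc n * t + n  <⟨ ℕ.+-monoʳ-< (suc n * t) (ℕ.n<1+n n) ⟩
  suc n * t + suc n ≡⟨ rearrange n t ⟩
  suc t * suc n  ∎))
  where
  open ℕ.≤-Reasoning
  rearrange : ∀ n t → suc n * t + suc n ≡ suc t * suc n
  rearrange = solve-∀

m≤b*⌈m/b⌉ : ∀ {b} → 0 < b → ∀ m → m ≤ b * ⌈ m / b ⌉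
m≤b*⌈m/b⌉ b>0 m = ⌈/⌉≤⇒≤* b>0 m _ ℕ.≤-refl

⌈/⌉-mono-≤ : ∀ {b} → 0 < b → ∀ {m n} → m ≤ n → ⌈ m / b ⌉ ≤ ⌈ n / b ⌉
⌈/⌉-mono-≤ b>0 {m} {n} m≤n = ≤*⇒⌈/⌉≤ b>0 m _ (ℕ.≤-trans m≤n (m≤b*⌈m/b⌉ b>0 n))

*≤⇒≤⌈/⌉ : ∀ {b} → 0 < b → ∀ m t → b * t ≤ m → t ≤ ⌈ m / b ⌉
*≤⇒≤⌈/⌉ {b} b>0 m t bt≤m = ℕ.*-cancelˡ-≤ b {{>-nonZero b>0}} (ℕ.≤-trans bt≤m (m≤b*⌈m/b⌉ b>0 m))

⌈/⌉≡suc⇒*< : ∀ {b} → 0 < b → ∀ m t → ⌈ m / b ⌉ ≡ suc t → b * t < m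
⌈/⌉≡suc⇒*< b>0 m t ⌈m/b⌉≡1+t =
  ℕ.≰⇒> (λ m≤bt → ℕ.1+n≰n (subst (_≤ t) ⌈m/b⌉≡1+t (≤*⇒⌈/⌉≤ b>0 m t m≤bt)))

⌈/1⌉ : ∀ m → ⌈ m / 1 ⌉ ≡ m
⌈/1⌉ m = trans (n/1≡n (m + 0)) (ℕ.+-identityʳ m)

⌈⌈/⌉/⌉ : ∀ {a b} → 0 < a → 0 < b → ∀ m → ⌈ ⌈ m / a ⌉ / b ⌉ ≡ ⌈ m / a * b ⌉
⌈⌈/⌉/⌉ {a@(suc _)} {b@(suc _)} a>0 b>0 m = ℕ.≤-antisym
  (≤*⇒⌈/⌉≤ b>0 _ _ (≤*⇒⌈/⌉≤ a>0 m _
    (ℕ.≤-trans (m≤b*⌈m/b⌉ ab>0 m) (ℕ.≤-reflexive (ℕ.*-assoc a b _)))))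
  (≤*⇒⌈/⌉≤ ab>0 m _
    (ℕ.≤-trans (⌈/⌉≤⇒≤* a>0 m _ (m≤b*⌈m/b⌉ b>0 _)) (ℕ.≤-reflexive (sym (ℕ.*-assoc a b _)))))
  where
  ab>0 : 0 < a * b
  ab>0 = z<s

⌈+*/⌉ : ∀ {b} → 0 < b → ∀ m t → ⌈ (m + t * b) / b ⌉ ≡ ⌈ m / b ⌉ + t
⌈+*/⌉ {suc n} _ m t = begin
  (m + t * suc n + n) / suc n   ≡⟨ cong (_/ suc n) (rearrange m (t * suc n) n) ⟩
  (m + n + t * suc n) / suc n   ≡⟨ +-distrib-/-∣ʳ (m + n) (divides t refl) ⟩
  (m + n) / suc n + t * suc n / suc n ≡⟨ cong ((m + n) / suc n +_) (m*n/n≡m t (suc n)) ⟩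
  (m + n) / suc n + t           ∎
  where
  open ≡-Reasoning
  rearrange : ∀ x y z → x + y + z ≡ x + z + y
  rearrange = solve-∀

repunit : ℕ → ℕ → ℕ
repunit q zero    = 0
repunit q (suc k) = q ^ k + repunit q k

suc[q-1]*repunit≡q^ : ∀ q′ k → suc (q′ * repunit (suc q′) k) ≡ suc q′ ^ k
suc[q-1]*repunit≡q^ q′ zero    = cong suc (ℕ.*-zeroʳ q′)
suc[q-1]*repunit≡q^ q′ (suc k) =
  trans (rearrange q′ (suc q′ ^ k) (repunit (suc q′) k)) (cong (_+ q′ * suc q′ ^ k) (suc[q-1]*repunit≡q^ q′ k))
  where
  rearrange : ∀ a b c → suc (a * (b + c)) ≡ suc (a * c) + a * b
  rearrange = solve-∀

module _ {q : ℕ} .{{_ : NonZero q}} where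

  private
    q>0 : 0 < q
    q>0 = >-nonZero⁻¹ q

    q^>0 : ∀ i → 0 < q ^ i
    q^>0 = ℕ.m^n>0 q

  griesmerFrom-suc : ∀ k i d → griesmerFrom q k (suc i) d ≡ griesmerFrom q k i ⌈ d / q ⌉
  griesmerFrom-suc zero    i d = refl
  griesmerFrom-suc (suc k) i d =
    cong₂ _+_ (sym (⌈⌈/⌉/⌉ q>0 (q^>0 i) d)) (griesmerFrom-suc k (suc i) d)

  griesmer-suc : ∀ k d → griesmer q (suc k) d ≡ d + griesmer q k ⌈ d / q ⌉
  griesmer-suc k d = cong₂ _+_ (⌈/1⌉ d) (griesmerFrom-suc k 0 d)

  griesmerFrom-mono-≤ : ∀ k i {d d′} → d ≤ d′ → griesmerFrom q k i d ≤ griesmerFrom q k i d′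
  griesmerFrom-mono-≤ zero    i d≤d′ = z≤n
  griesmerFrom-mono-≤ (suc k) i d≤d′ =
    ℕ.+-mono-≤ (⌈/⌉-mono-≤ (q^>0 i) d≤d′) (griesmerFrom-mono-≤ k (suc i) d≤d′)

  griesmerFrom-snoc : ∀ k i d → griesmerFrom q (suc k) i d ≡ griesmerFrom q k i d + ⌈ d / q ^ (i + k) ⌉
  griesmerFrom-snoc zero    i d rewrite ℕ.+-identityʳ i = ℕ.+-comm ⌈ d / q ^ i ⌉ 0
  griesmerFrom-snoc (suc k) i d rewrite ℕ.+-suc i k | griesmerFrom-snoc k (suc i) d =
    sym (ℕ.+-assoc ⌈ d / q ^ i ⌉ _ _)

  ⌈+*^/^⌉ : ∀ d t i j → ⌈ (d + t * q ^ (i + j)) / q ^ i ⌉ ≡ ⌈ d / q ^ i ⌉ + t * q ^ j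
  ⌈+*^/^⌉ d t i j = begin
    ⌈ (d + t * q ^ (i + j)) / q ^ i ⌉   ≡⟨ cong (λ e → ⌈ (d + e) / q ^ i ⌉) t*q^[i+j]≡t*q^j*q^i ⟩
    ⌈ (d + t * q ^ j * q ^ i) / q ^ i ⌉ ≡⟨ ⌈+*/⌉ (q^>0 i) d (t * q ^ j) ⟩
    ⌈ d / q ^ i ⌉ + t * q ^ j           ∎
    where
    open ≡-Reasoning
    t*q^[i+j]≡t*q^j*q^i : t * q ^ (i + j) ≡ t * q ^ j * q ^ i
    t*q^[i+j]≡t*q^j*q^i rewrite ℕ.^-distribˡ-+-* q i j = rearrange t (q ^ i) (q ^ j)
      where
      rearrange : ∀ t a b → t * (a * b) ≡ t * b * a
      rearrange = solve-∀

  griesmerFrom-+* : ∀ k i d t →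
    griesmerFrom q (suc k) i (d + t * q ^ (i + k)) ≡ griesmerFrom q (suc k) i d + t * repunit q (suc k)
  griesmerFrom-+* zero i d t rewrite ⌈+*^/^⌉ d t i 0 = rearrange ⌈ d / q ^ i ⌉ t
    where
    rearrange : ∀ a t → a + t * 1 + 0 ≡ a + 0 + t * (1 + 0)
    rearrange = solve-∀
  griesmerFrom-+* (suc k) i d t rewrite ⌈+*^/^⌉ d t i (suc k) | ℕ.+-suc i k | griesmerFrom-+* k (suc i) d t =
    rearrange ⌈ d / q ^ i ⌉ t (q ^ suc k) (griesmerFrom q (suc k) (suc i) d) (repunit q (suc k))
    where
    rearrange : ∀ a t p g r → a + t * p + (g + t * r) ≡ a + g + t * (p + r)
    rearrange = solve-∀


sum-const : ∀ n c → sum {n} (λ _ → c) ≡ n * c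
sum-const zero    c = refl
sum-const (suc n) c = cong (c +_) (sum-const n c)

sum-mono-≤ : ∀ {n} {f g : Fin n → ℕ} → (∀ i → f i ≤ g i) → sum f ≤ sum g
sum-mono-≤ {zero}  f≤g = z≤n
sum-mono-≤ {suc n} f≤g = ℕ.+-mono-≤ (f≤g zero) (sum-mono-≤ (λ i → f≤g (suc i)))

sum-uniqueZero : ∀ {n} (f : Fin (suc n) → ℕ) i → f i ≡ 0 → (∀ j → j ≢ i → f j ≡ 1) → sum f ≡ n
sum-uniqueZero {n} f i fi≡0 f≡1 = begin
  sum f                             ≡⟨ sum-remove {i = i} f ⟩
  f i + sum (λ j → f (punchIn i j)) ≡⟨ cong₂ _+_ fi≡0 (sum-cong-≗ (λ j → f≡1 _ (punchInᵢ≢i i j))) ⟩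
  sum {n} (λ _ → 1)                 ≡⟨ trans (sum-const n 1) (ℕ.*-identityʳ n) ⟩
  n                                 ∎
  where open ≡-Reasoning

module _ {A : Set} where

  sumOver : List A → (A → ℕ) → ℕ
  sumOver xs f = sumₗ (map f xs)

  sumOver-++ : ∀ xs ys f → sumOver (xs ++ ys) f ≡ sumOver xs f + sumOver ys f
  sumOver-++ xs ys f = trans (cong sumₗ (map-++ f xs ys)) (sumₗ-++ (map f xs) (map f ys))

  sumOver-cong : ∀ xs {f g : A → ℕ} → (∀ x → f x ≡ g x) → sumOver xs f ≡ sumOver xs g
  sumOver-cong xs f≗g = cong sumₗ (map-cong f≗g xs)

  length≡sumOver-1 : ∀ xs → length xs ≡ sumOver xs (λ _ → 1)
  length≡sumOver-1 []       = refl
  length≡sumOver-1 (x ∷ xs) = cong suc (length≡sumOver-1 xs)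

  sum-sumOver-comm : ∀ {n} xs (f : Fin n → A → ℕ) →
    sum (λ i → sumOver xs (f i)) ≡ sumOver xs (λ x → sum (λ i → f i x))
  sum-sumOver-comm {n} []  f = trans (sum-const n 0) (ℕ.*-zeroʳ n)
  sum-sumOver-comm (x ∷ xs) f =
    trans (sum-distrib-+ (λ i → f i x) (λ i → sumOver xs (f i)))
          (cong (sum (λ i → f i x) +_) (sum-sumOver-comm xs f))

  sumOver-foldr-++ : ∀ {n} (xss : Vector (List A) n) f →
    sumOver (V.foldr _++_ [] xss) f ≡ sum (λ i → sumOver (xss i) f)
  sumOver-foldr-++ {zero}  xss f = refl
  sumOver-foldr-++ {suc n} xss f =
    trans (sumOver-++ (xss zero) _ f)
          (cong (sumOver (xss zero) f +_) (sumOver-foldr-++ (λ i → xss (suc i)) f))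

  ∈-foldr-++⁺ : ∀ {n} {x : A} (xss : Vector (List A) n) i → x ∈ xss i → x ∈ V.foldr _++_ [] xss
  ∈-foldr-++⁺ xss zero    x∈xss₀ = ∈-++⁺ˡ x∈xss₀
  ∈-foldr-++⁺ xss (suc i) x∈xssᵢ = ∈-++⁺ʳ (xss zero) (∈-foldr-++⁺ (λ j → xss (suc j)) i x∈xssᵢ)

  sumOver-copies : ∀ n (xs : List A) f → sumOver (concat (replicate n xs)) f ≡ n * sumOver xs f
  sumOver-copies zero    xs f = refl
  sumOver-copies (suc n) xs f = trans (sumOver-++ xs _ f) (cong (sumOver xs f +_) (sumOver-copies n xs f))

sumOver-map : ∀ {A B : Set} (g : A → B) xs f → sumOver (map g xs) f ≡ sumOver xs (f ∘ g)
sumOver-map g xs f = cong sumₗ (sym (map-∘ xs))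

module _ {A : Set} where

  concat-replicate⊆ : ∀ n (xs : List A) → concat (replicate n xs) ⊆ xs
  concat-replicate⊆ (suc n) xs x∈copies with ∈-++⁻ xs x∈copies
  ... | inj₁ x∈xs   = x∈xs
  ... | inj₂ x∈rest = concat-replicate⊆ n xs x∈rest

  Repeated : List A → Set
  Repeated xs = ∀ i → ∃ λ j → j ≢ i × lookup xs j ≡ lookup xs i

  private
    index-∈-++⁺ˡ : ∀ {x : A} {xs ys} (p : x ∈ xs) → toℕ (index (∈-++⁺ˡ {ys = ys} p)) ≡ toℕ (index p)
    index-∈-++⁺ˡ (here _) = refl
    index-∈-++⁺ˡ (there p) = cong suc (index-∈-++⁺ˡ p)

    index-∈-++⁺ʳ : ∀ {x : A} xs {ys} (p : x ∈ ys) →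
      toℕ (index (∈-++⁺ʳ xs p)) ≡ length xs + toℕ (index p)
    index-∈-++⁺ʳ []       p = refl
    index-∈-++⁺ʳ (y ∷ xs) p = cong suc (index-∈-++⁺ʳ xs p)

    index-∈-++⁺ˡ≢index-∈-++⁺ʳ : ∀ {x : A} {xs ys} (p : x ∈ xs) (p′ : x ∈ ys) →
      index (∈-++⁺ˡ {ys = ys} p) ≢ index (∈-++⁺ʳ xs p′)
    index-∈-++⁺ˡ≢index-∈-++⁺ʳ {xs = xs} p p′ same = ℕ.<⇒≢ (begin-strict
      toℕ (index (∈-++⁺ˡ p))        ≡⟨ index-∈-++⁺ˡ p ⟩
      toℕ (index p)                 <⟨ toℕ<n (index p) ⟩
      length xs                     ≤⟨ ℕ.m≤m+n (length xs) _ ⟩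
      length xs + toℕ (index p′)    ≡⟨ index-∈-++⁺ʳ xs p′ ⟨
      toℕ (index (∈-++⁺ʳ xs p′))   ∎) (cong toℕ same)
      where open ℕ.≤-Reasoning

    two-occurrences⇒repeated : ∀ (zs : List A) i (p p′ : lookup zs i ∈ zs) → index p ≢ index p′ →
      ∃ λ j → j ≢ i × lookup zs j ≡ lookup zs i
    two-occurrences⇒repeated zs i p p′ p≢p′ with index p Fin.≟ i
    ... | yes p≡i = index p′ , (λ p′≡i → p≢p′ (trans p≡i (sym p′≡i))) , sym (lookup-index p′)
    ... | no  p≢i = index p , p≢i , sym (lookup-index p)

  repeated-++ : ∀ {xs ys : List A} → xs ⊆ ys → ys ⊆ xs → Repeated (xs ++ ys)
  repeated-++ {xs} {ys} xs⊆ys ys⊆xs i with ∈-++⁻ xs (∈-lookup {xs = xs ++ ys} i)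
  ... | inj₁ x∈xs = two-occurrences⇒repeated (xs ++ ys) i (∈-++⁺ˡ x∈xs) (∈-++⁺ʳ xs (xs⊆ys x∈xs))
                      (index-∈-++⁺ˡ≢index-∈-++⁺ʳ x∈xs (xs⊆ys x∈xs))
  ... | inj₂ x∈ys = two-occurrences⇒repeated (xs ++ ys) i (∈-++⁺ˡ (ys⊆xs x∈ys)) (∈-++⁺ʳ xs x∈ys)
                      (index-∈-++⁺ˡ≢index-∈-++⁺ʳ (ys⊆xs x∈ys) x∈ys)

module FieldLemmas {q : ℕ} (F : FiniteField q) where

  open FiniteField F hiding (zero)
    renaming (_+_ to _+ᶠ_; _*_ to _*ᶠ_; -_ to -ᶠ_; refl to ≈-refl; sym to ≈-sym; trans to ≈-trans)
  open GroupProperties +-group using (∙-cancelˡ; x∙y⁻¹≈ε⇒x≈y; x≈y⇒x∙y⁻¹≈ε)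
  open RingProperties ring using (-1*x≈-x)
  open SetoidReasoning setoid

  private
    inverse-cancelˡ : ∀ {a b} → a *ᶠ b ≈ 1# → ∀ e → b *ᶠ (a *ᶠ e) ≈ e
    inverse-cancelˡ {a} {b} ab≈1 e = begin
      b *ᶠ (a *ᶠ e) ≈⟨ *-assoc b a e ⟨
      b *ᶠ a *ᶠ e   ≈⟨ *-congʳ (≈-trans (*-comm b a) ab≈1) ⟩
      1# *ᶠ e       ≈⟨ *-identityˡ e ⟩
      e             ∎

  x*y≈0⇒x≈0 : ∀ {x y} → y ≉ 0# → x *ᶠ y ≈ 0# → x ≈ 0#
  x*y≈0⇒x≈0 {x} {y} y≉0 xy≈0 with inverse y y≉0
  ... | z , yz≈1 = begin
    x                ≈⟨ inverse-cancelˡ yz≈1 x ⟨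
    z *ᶠ (y *ᶠ x)    ≈⟨ *-congˡ (≈-trans (*-comm y x) xy≈0) ⟩
    z *ᶠ 0#          ≈⟨ zeroʳ z ⟩
    0#               ∎

  *-cancelʳ-≉0 : ∀ {a e e′} → a ≉ 0# → e *ᶠ a ≈ e′ *ᶠ a → e ≈ e′
  *-cancelʳ-≉0 {a} {e} {e′} a≉0 ea≈e′a with inverse a a≉0
  ... | b , ab≈1 = begin
    e                ≈⟨ inverse-cancelˡ ab≈1 e ⟨
    b *ᶠ (a *ᶠ e)    ≈⟨ *-congˡ (≈-trans (*-comm a e) (≈-trans ea≈e′a (*-comm e′ a))) ⟩
    b *ᶠ (a *ᶠ e′)   ≈⟨ inverse-cancelˡ ab≈1 e′ ⟩
    e′               ∎

  affine-root : ∀ {a} c → a ≉ 0# → ∃ λ e → c +ᶠ e *ᶠ a ≈ 0#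
  affine-root {a} c a≉0 with inverse a a≉0
  ... | b , ab≈1 = -ᶠ c *ᶠ b , (begin
    c +ᶠ -ᶠ c *ᶠ b *ᶠ a     ≈⟨ +-congˡ (*-assoc (-ᶠ c) b a) ⟩
    c +ᶠ -ᶠ c *ᶠ (b *ᶠ a)   ≈⟨ +-congˡ (*-congˡ (≈-trans (*-comm b a) ab≈1)) ⟩
    c +ᶠ -ᶠ c *ᶠ 1#         ≈⟨ +-congˡ (*-identityʳ (-ᶠ c)) ⟩
    c +ᶠ -ᶠ c               ≈⟨ -‿inverseʳ c ⟩
    0#                      ∎)

  affine-root-unique : ∀ {a c e e′} → a ≉ 0# → c +ᶠ e *ᶠ a ≈ 0# → c +ᶠ e′ *ᶠ a ≈ 0# → e ≈ e′
  affine-root-unique {a} {c} a≉0 root root′ =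
    *-cancelʳ-≉0 a≉0 (∙-cancelˡ c _ _ (≈-trans root (≈-sym root′)))

  x+-1*y≈0⇒x≈y : ∀ {x y} → x +ᶠ -ᶠ 1# *ᶠ y ≈ 0# → x ≈ y
  x+-1*y≈0⇒x≈y {x} {y} x-y≈0 = x∙y⁻¹≈ε⇒x≈y x y (≈-trans (+-congˡ (≈-sym (-1*x≈-x y))) x-y≈0)

  x≈y⇒x+-1*y≈0 : ∀ {x y} → x ≈ y → x +ᶠ -ᶠ 1# *ᶠ y ≈ 0#
  x≈y⇒x+-1*y≈0 {x} {y} x≈y = ≈-trans (+-congˡ (-1*x≈-x y)) (x≈y⇒x∙y⁻¹≈ε x≈y)

module DotProduct {q : ℕ} (F : FiniteField q) where

  open FiniteField F hiding (zero)
    renaming (_+_ to _+ᶠ_; _*_ to _*ᶠ_; -_ to -ᶠ_; refl to ≈-refl; sym to ≈-sym; trans to ≈-trans)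
  open Codes F using (∑)
  open CommutativeSemigroupProperties +-commutativeSemigroup using (interchange)
  open SetoidReasoning setoid

  ∑-cong : ∀ {k} {f g : Vector Carrier k} → (∀ i → f i ≈ g i) → ∑ f ≈ ∑ g
  ∑-cong {zero}  f≈g = ≈-refl
  ∑-cong {suc k} f≈g = +-cong (f≈g zero) (∑-cong (λ i → f≈g (suc i)))

  ∑-zero : ∀ {k} {f : Vector Carrier k} → (∀ i → f i ≈ 0#) → ∑ f ≈ 0#
  ∑-zero {zero}  f≈0 = ≈-refl
  ∑-zero {suc k} f≈0 = ≈-trans (+-cong (f≈0 zero) (∑-zero (λ i → f≈0 (suc i)))) (+-identityʳ 0#)

  ∑-distrib-+ : ∀ {k} (f g : Vector Carrier k) → ∑ (λ i → f i +ᶠ g i) ≈ ∑ f +ᶠ ∑ g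
  ∑-distrib-+ {zero}  f g = ≈-sym (+-identityʳ 0#)
  ∑-distrib-+ {suc k} f g =
    ≈-trans (+-congˡ (∑-distrib-+ (λ i → f (suc i)) (λ i → g (suc i)))) (interchange _ _ _ _)

  *-distribˡ-∑ : ∀ {k} c (f : Vector Carrier k) → ∑ (λ i → c *ᶠ f i) ≈ c *ᶠ ∑ f
  *-distribˡ-∑ {zero}  c f = ≈-sym (zeroʳ c)
  *-distribˡ-∑ {suc k} c f = ≈-trans (+-congˡ (*-distribˡ-∑ c (λ i → f (suc i)))) (≈-sym (distribˡ c _ _))

  infix 7 _∙_
  _∙_ : ∀ {k} → Vector Carrier k → Vector Carrier k → Carrier
  x ∙ v = ∑ (λ i → x i *ᶠ v i)

  ∙-congˡ : ∀ {k} {x y : Vector Carrier k} v → (∀ i → x i ≈ y i) → x ∙ v ≈ y ∙ v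
  ∙-congˡ v x≈y = ∑-cong (λ i → *-congʳ (x≈y i))

  ∙-zeroˡ : ∀ {k} {x : Vector Carrier k} v → (∀ i → x i ≈ 0#) → x ∙ v ≈ 0#
  ∙-zeroˡ v x≈0 = ∑-zero (λ i → ≈-trans (*-congʳ (x≈0 i)) (zeroˡ (v i)))

  infix 6 _+ᵛ_·_
  _+ᵛ_·_ : ∀ {k} → Vector Carrier k → Carrier → Vector Carrier k → Vector Carrier k
  (x +ᵛ e · y) i = x i +ᶠ e *ᶠ y i

  ∙-+ᵛ· : ∀ {k} (x y : Vector Carrier k) e v → (x +ᵛ e · y) ∙ v ≈ x ∙ v +ᶠ e *ᶠ (y ∙ v)
  ∙-+ᵛ· x y e v = begin
    ∑ (λ i → (x i +ᶠ e *ᶠ y i) *ᶠ v i)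
      ≈⟨ ∑-cong (λ i → ≈-trans (distribʳ (v i) _ _) (+-congˡ (*-assoc e (y i) (v i)))) ⟩
    ∑ (λ i → x i *ᶠ v i +ᶠ e *ᶠ (y i *ᶠ v i))
      ≈⟨ ∑-distrib-+ (λ i → x i *ᶠ v i) (λ i → e *ᶠ (y i *ᶠ v i)) ⟩
    x ∙ v +ᶠ ∑ (λ i → e *ᶠ (y i *ᶠ v i))
      ≈⟨ +-congˡ (*-distribˡ-∑ e (λ i → y i *ᶠ v i)) ⟩
    x ∙ v +ᶠ e *ᶠ (y ∙ v) ∎

  insertAt-0-∙ : ∀ {k} (x : Vector Carrier k) i v → insertAt x i 0# ∙ v ≈ x ∙ removeAt v i
  insertAt-0-∙ x zero v = ≈-trans (+-congʳ (zeroˡ (v zero))) (+-identityˡ _)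
  insertAt-0-∙ {suc k} x (suc i) v = +-congˡ (insertAt-0-∙ (λ j → x (suc j)) i (λ j → v (suc j)))

module Enumeration {q : ℕ} (F : FiniteField q) where

  open FiniteField F using (Carrier; _≈_; enum; enum-surj) renaming (sym to ≈-sym)

  vectors : ∀ k → List (Vector Carrier k)
  vectors zero    = V.[] ∷ []
  vectors (suc k) = V.foldr _++_ [] (λ i → map (enum i V.∷_) (vectors k))

  sumOver-vectors-suc : ∀ k f →
    sumOver (vectors (suc k)) f ≡ sum (λ i → sumOver (vectors k) (λ v → f (enum i V.∷ v)))
  sumOver-vectors-suc k f = trans (sumOver-foldr-++ (λ i → map (enum i V.∷_) (vectors k)) f)
                                  (sum-cong-≗ (λ i → sumOver-map (enum i V.∷_) (vectors k) f))

  sumOver-vectors-const : ∀ k c → sumOver (vectors k) (λ _ → c) ≡ q ^ k * c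
  sumOver-vectors-const zero    c = trans (ℕ.+-identityʳ c) (sym (ℕ.*-identityˡ c))
  sumOver-vectors-const (suc k) c = begin
    sumOver (vectors (suc k)) (λ _ → c)         ≡⟨ sumOver-vectors-suc k (λ _ → c) ⟩
    sum {q} (λ _ → sumOver (vectors k) (λ _ → c)) ≡⟨ sum-const q _ ⟩
    q * sumOver (vectors k) (λ _ → c)           ≡⟨ cong (q *_) (sumOver-vectors-const k c) ⟩
    q * (q ^ k * c)                             ≡⟨ ℕ.*-assoc q (q ^ k) c ⟨
    q ^ suc k * c                               ∎
    where open ≡-Reasoning

  ∈-vectors : ∀ {k} (x : Vector Carrier k) → ∃ λ v → v ∈ vectors k × (∀ i → x i ≈ v i)
  ∈-vectors {zero}  x = V.[] , here refl , λ ()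
  ∈-vectors {suc k} x with enum-surj (x zero) | ∈-vectors (V.tail x)
  ... | i , enumᵢ≈x₀ | v , v∈vectors , tail-x≈v =
    enum i V.∷ v , ∈-foldr-++⁺ _ i (∈-map⁺ (enum i V.∷_) v∈vectors) ,
    λ { zero → ≈-sym enumᵢ≈x₀ ; (suc j) → tail-x≈v j }

module Weights {q′ : ℕ} (F : FiniteField (suc q′)) where

  open FiniteField F hiding (zero)
    renaming (_+_ to _+ᶠ_; _*_ to _*ᶠ_; -_ to -ᶠ_; refl to ≈-refl; sym to ≈-sym; trans to ≈-trans)
  open FieldLemmas F
  open DotProduct F

  private
    q : ℕ
    q = suc q′

  [≉0] : Carrier → ℕ
  [≉0] a with a ≟ 0#
  ... | yes _ = 0
  ... | no  _ = 1

  [≉0]-≈0 : ∀ {a} → a ≈ 0# → [≉0] a ≡ 0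
  [≉0]-≈0 {a} a≈0 with a ≟ 0#
  ... | yes _   = refl
  ... | no a≉0 = contradiction a≈0 a≉0

  [≉0]-≉0 : ∀ {a} → a ≉ 0# → [≉0] a ≡ 1
  [≉0]-≉0 {a} a≉0 with a ≟ 0#
  ... | yes a≈0 = contradiction a≈0 a≉0
  ... | no _    = refl

  [≉0]-cong : ∀ {a b} → a ≈ b → [≉0] a ≡ [≉0] b
  [≉0]-cong {a} {b} a≈b with b ≟ 0#
  ... | yes b≈0 = [≉0]-≈0 (≈-trans a≈b b≈0)
  ... | no  b≉0 = [≉0]-≉0 (λ a≈0 → b≉0 (≈-trans (≈-sym a≈b) a≈0))

  sum-[≉0]-affine : ∀ c {a} → a ≉ 0# → sum (λ i → [≉0] (c +ᶠ enum i *ᶠ a)) ≡ q′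
  sum-[≉0]-affine c a≉0 with affine-root c a≉0
  ... | e , root with enum-surj e
  ... | i , enumᵢ≈e = sum-uniqueZero _ i ([≉0]-≈0 (≈-trans (+-congˡ (*-congʳ enumᵢ≈e)) root))
    (λ j j≢i → [≉0]-≉0 (λ rootⱼ → j≢i (enum-inj j i
      (≈-trans (affine-root-unique a≉0 rootⱼ root) (≈-sym enumᵢ≈e)))))

  sum-[≉0]-constant : ∀ c {a} → a ≈ 0# → sum (λ i → [≉0] (c +ᶠ enum i *ᶠ a)) ≡ q * [≉0] c
  sum-[≉0]-constant c a≈0 = trans
    (sum-cong-≗ (λ i → [≉0]-cong (≈-trans (+-congˡ (≈-trans (*-congˡ a≈0) (zeroʳ (enum i))))
                                          (+-identityʳ c))))
    (sum-const q ([≉0] c))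

  -- A code is given by the list L of columns of a generator matrix; weight L x is the Hamming
  -- weight of the codeword x·G.
  weight : ∀ {k} → List (Vector Carrier k) → Vector Carrier k → ℕ
  weight L x = sumOver L (λ v → [≉0] (x ∙ v))

  weight-cong : ∀ {k} (L : List (Vector Carrier k)) {x y} → (∀ i → x i ≈ y i) → weight L x ≡ weight L y
  weight-cong L x≈y = sumOver-cong L (λ v → [≉0]-cong (∙-congˡ v x≈y))

  NonzeroVector : ∀ {k} → Vector Carrier k → Set
  NonzeroVector x = ¬ (∀ i → x i ≈ 0#)

  MinWeight : ∀ {k} → List (Vector Carrier k) → ℕ → Set
  MinWeight L d = ∀ x → NonzeroVector x → d ≤ weight L x

module GriesmerBound {q′ : ℕ} (F : FiniteField (suc q′)) where

  open FiniteField F hiding (zero)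
    renaming (_+_ to _+ᶠ_; _*_ to _*ᶠ_; -_ to -ᶠ_; refl to ≈-refl; sym to ≈-sym; trans to ≈-trans)
  open FieldLemmas F
  open DotProduct F
  open Enumeration F
  open Weights F

  private
    q : ℕ
    q = suc q′

  nonzero? : ∀ {k} (x : Vector Carrier k) → Dec (NonzeroVector x)
  nonzero? x = ¬? (all? (λ i → x i ≟ 0#))

  minimumWeight-attained : ∀ {k} (L : List (Vector Carrier (suc k))) →
    ∃ λ x₀ → NonzeroVector x₀ × (∀ x → NonzeroVector x → weight L x₀ ≤ weight L x)
  minimumWeight-attained {k} L = x₀ , x₀≢0 , x₀-minimal
    where
    candidates : List (Vector Carrier (suc k))
    candidates = filter nonzero? (vectors (suc k))
    e₀ : Vector Carrier (suc k)
    e₀ = 1# V.∷ λ _ → 0#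
    x₀ : Vector Carrier (suc k)
    x₀ = argmin (weight L) e₀ candidates
    x₀≢0 : NonzeroVector x₀
    x₀≢0 = argmin-all (weight L) (λ e₀≈0 → 1≉0 (e₀≈0 zero)) (all-filter nonzero? (vectors (suc k)))
    x₀-minimal : ∀ x → NonzeroVector x → weight L x₀ ≤ weight L x
    x₀-minimal x x≢0 with ∈-vectors x
    ... | v , v∈vectors , x≈v = subst (weight L x₀ ≤_) (sym (weight-cong L x≈v))
      (All.lookup (f[argmin]≤f[xs] e₀ candidates) (∈-filter⁺ nonzero? v∈vectors v≢0))
      where
      v≢0 : NonzeroVector v
      v≢0 v≈0 = x≢0 (λ i → ≈-trans (x≈v i) (v≈0 i))

  orthogonal : ∀ {k} → Vector Carrier k → List (Vector Carrier k) → List (Vector Carrier k)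
  orthogonal x₀ = filter (λ v → (x₀ ∙ v) ≟ 0#)

  residual : ∀ {k} → Vector Carrier (suc k) → Fin (suc k) →
    List (Vector Carrier (suc k)) → List (Vector Carrier k)
  residual x₀ i₀ L = map (λ v → removeAt v i₀) (orthogonal x₀ L)

  length≡weight+orthogonal : ∀ {k} (x₀ : Vector Carrier k) L →
    length L ≡ weight L x₀ + length (orthogonal x₀ L)
  length≡weight+orthogonal x₀ []      = refl
  length≡weight+orthogonal x₀ (v ∷ L) with (x₀ ∙ v) ≟ 0#
  ... | yes _ = trans (cong suc (length≡weight+orthogonal x₀ L)) (sym (ℕ.+-suc _ _))
  ... | no  _ = cong suc (length≡weight+orthogonal x₀ L)

  sum-weight-line : ∀ {k} (x x₀ : Vector Carrier k) L →
    sum (λ i → weight L (x +ᵛ enum i · x₀)) ≡ q * weight (orthogonal x₀ L) x + q′ * weight L x₀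
  sum-weight-line x x₀ L = trans (sum-sumOver-comm L (λ i v → [≉0] ((x +ᵛ enum i · x₀) ∙ v))) (go L)
    where
    column : ∀ v →
      sum (λ i → [≉0] ((x +ᵛ enum i · x₀) ∙ v)) ≡ sum (λ i → [≉0] (x ∙ v +ᶠ enum i *ᶠ (x₀ ∙ v)))
    column v = sum-cong-≗ (λ i → [≉0]-cong (∙-+ᵛ· x x₀ (enum i) v))
    go : ∀ L → sumOver L (λ v → sum (λ i → [≉0] ((x +ᵛ enum i · x₀) ∙ v)))
             ≡ q * weight (orthogonal x₀ L) x + q′ * weight L x₀
    go []      = cong₂ _+_ (sym (ℕ.*-zeroʳ q)) (sym (ℕ.*-zeroʳ q′))
    go (v ∷ L) with (x₀ ∙ v) ≟ 0#
    ... | yes x₀∙v≈0 =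
      trans (cong₂ _+_ (trans (column v) (sum-[≉0]-constant (x ∙ v) x₀∙v≈0)) (go L))
            (rearrange q q′ ([≉0] (x ∙ v)) _ _)
      where
      rearrange : ∀ q q′ a W₀ W → q * a + (q * W₀ + q′ * W) ≡ q * (a + W₀) + q′ * (0 + W)
      rearrange = solve-∀
    ... | no  x₀∙v≉0 =
      trans (cong₂ _+_ (trans (column v) (sum-[≉0]-affine (x ∙ v) x₀∙v≉0)) (go L))
            (rearrange q q′ _ _)
      where
      rearrange : ∀ q q′ W₀ W → q′ + (q * W₀ + q′ * W) ≡ q * W₀ + q′ * (1 + W)
      rearrange = solve-∀

  weight-residual : ∀ {k} x₀ i₀ (L : List (Vector Carrier (suc k))) x′ →
    weight (orthogonal x₀ L) (insertAt x′ i₀ 0#) ≡ weight (residual x₀ i₀ L) x′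
  weight-residual x₀ i₀ L x′ = trans
    (sumOver-cong (orthogonal x₀ L) (λ v → [≉0]-cong (insertAt-0-∙ x′ i₀ v)))
    (sym (sumOver-map (λ v → removeAt v i₀) (orthogonal x₀ L) (λ v → [≉0] (x′ ∙ v))))

  line-nonzero : ∀ {k} (x x₀ : Vector Carrier k) i₀ → x i₀ ≈ 0# → x₀ i₀ ≉ 0# →
    NonzeroVector x → ∀ e → NonzeroVector (x +ᵛ e · x₀)
  line-nonzero x x₀ i₀ xᵢ₀≈0 x₀ᵢ₀≉0 x≢0 e line≈0 = x≢0 (λ j → begin
    x j               ≈⟨ +-identityʳ (x j) ⟨
    x j +ᶠ 0#         ≈⟨ +-congˡ (≈-trans (*-congʳ e≈0) (zeroˡ (x₀ j))) ⟨
    x j +ᶠ e *ᶠ x₀ j  ≈⟨ line≈0 j ⟩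
    0#                ∎)
    where
    open SetoidReasoning setoid
    e≈0 : e ≈ 0#
    e≈0 = x*y≈0⇒x≈0 x₀ᵢ₀≉0 (begin
      e *ᶠ x₀ i₀          ≈⟨ +-identityˡ _ ⟨
      0# +ᶠ e *ᶠ x₀ i₀    ≈⟨ +-congʳ xᵢ₀≈0 ⟨
      x i₀ +ᶠ e *ᶠ x₀ i₀  ≈⟨ line≈0 i₀ ⟩
      0#                  ∎)

  residual-weight : ∀ {k} (L : List (Vector Carrier (suc k))) x₀ i₀ → x₀ i₀ ≉ 0# →
    (∀ x → NonzeroVector x → weight L x₀ ≤ weight L x) →
    ∀ x′ → NonzeroVector x′ → weight L x₀ ≤ q * weight (residual x₀ i₀ L) x′
  residual-weight L x₀ i₀ x₀ᵢ₀≉0 x₀-minimal x′ x′≢0 = ℕ.+-cancelʳ-≤ (q′ * w) w (q * W) (begin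
    w + q′ * w                               ≡⟨ sum-const q w ⟨
    sum {q} (λ _ → w)                        ≤⟨ sum-mono-≤ (λ i → x₀-minimal _ (line≢0 (enum i))) ⟩
    sum (λ i → weight L (x +ᵛ enum i · x₀))  ≡⟨ sum-weight-line x x₀ L ⟩
    q * weight (orthogonal x₀ L) x + q′ * w  ≡⟨ cong (λ W → q * W + q′ * w) (weight-residual x₀ i₀ L x′) ⟩
    q * W + q′ * w                           ∎)
    where
    open ℕ.≤-Reasoning
    w W : ℕ
    w = weight L x₀
    W = weight (residual x₀ i₀ L) x′
    x : Vector Carrier (suc _)
    x = insertAt x′ i₀ 0#
    xᵢ₀≈0 : x i₀ ≈ 0#
    xᵢ₀≈0 = reflexive (insertAt-lookup x′ i₀ 0#)
    x≢0 : NonzeroVector x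
    x≢0 x≈0 = x′≢0 (λ j → subst (_≈ 0#) (insertAt-punchIn x′ i₀ 0# j) (x≈0 (punchIn i₀ j)))
    line≢0 : ∀ e → NonzeroVector (x +ᵛ e · x₀)
    line≢0 = line-nonzero x x₀ i₀ xᵢ₀≈0 x₀ᵢ₀≉0 x≢0

  griesmer-bound : ∀ k (L : List (Vector Carrier k)) d → MinWeight L d → griesmer q k d ≤ length L
  griesmer-bound zero    L d _         = z≤n
  griesmer-bound (suc k) L d minWeight with minimumWeight-attained L
  ... | x₀ , x₀≢0 , x₀-minimal with ¬∀⟶∃¬ (suc k) _ (λ i → x₀ i ≟ 0#) x₀≢0
  ... | i₀ , x₀ᵢ₀≉0 = begin
    griesmer q (suc k) d           ≡⟨ griesmer-suc k d ⟩
    d + griesmer q k ⌈ d / q ⌉     ≤⟨ ℕ.+-mono-≤ d≤w (griesmerFrom-mono-≤ k 0 (⌈/⌉-mono-≤ z<s d≤w)) ⟩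
    w + griesmer q k ⌈ w / q ⌉     ≤⟨ ℕ.+-monoʳ-≤ w (griesmer-bound k (residual x₀ i₀ L) _ residual-minWeight) ⟩
    w + length (residual x₀ i₀ L)  ≡⟨ cong (w +_) (length-map _ (orthogonal x₀ L)) ⟩
    w + length (orthogonal x₀ L)   ≡⟨ length≡weight+orthogonal x₀ L ⟨
    length L                       ∎
    where
    open ℕ.≤-Reasoning
    w : ℕ
    w = weight L x₀
    d≤w : d ≤ w
    d≤w = minWeight x₀ x₀≢0
    residual-minWeight : MinWeight (residual x₀ i₀ L) ⌈ w / q ⌉
    residual-minWeight x′ x′≢0 =
      ≤*⇒⌈/⌉≤ z<s w _ (residual-weight L x₀ i₀ x₀ᵢ₀≉0 x₀-minimal x′ x′≢0)

module Construction {q′ : ℕ} (F : FiniteField (suc q′)) where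

  open FiniteField F hiding (zero)
    renaming (_+_ to _+ᶠ_; _*_ to _*ᶠ_; -_ to -ᶠ_; refl to ≈-refl; sym to ≈-sym; trans to ≈-trans)
  open DotProduct F
  open Enumeration F
  open Weights F

  private
    q : ℕ
    q = suc q′

  count-affine-nonzero-head : ∀ K c (y : Vector Carrier (suc K)) → y zero ≉ 0# →
    sumOver (vectors (suc K)) (λ v → [≉0] (c +ᶠ y ∙ v)) ≡ q′ * q ^ K
  count-affine-nonzero-head K c y y₀≉0 = begin
    sumOver (vectors (suc K)) (λ v → [≉0] (c +ᶠ y ∙ v))
      ≡⟨ sumOver-vectors-suc K _ ⟩
    sum (λ i → sumOver (vectors K) (λ v → [≉0] (c +ᶠ (y zero *ᶠ enum i +ᶠ V.tail y ∙ v))))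
      ≡⟨ sum-sumOver-comm (vectors K) (λ i v → [≉0] (c +ᶠ (y zero *ᶠ enum i +ᶠ V.tail y ∙ v))) ⟩
    sumOver (vectors K) (λ v → sum (λ i → [≉0] (c +ᶠ (y zero *ᶠ enum i +ᶠ V.tail y ∙ v))))
      ≡⟨ sumOver-cong (vectors K) (λ v → trans (sum-cong-≗ (λ i → [≉0]-cong (rearrange v (enum i))))
                                               (sum-[≉0]-affine (c +ᶠ V.tail y ∙ v) y₀≉0)) ⟩
    sumOver (vectors K) (λ _ → q′)
      ≡⟨ sumOver-vectors-const K q′ ⟩
    q ^ K * q′
      ≡⟨ ℕ.*-comm (q ^ K) q′ ⟩
    q′ * q ^ K ∎
    where
    open ≡-Reasoning
    rearrange : ∀ v e → c +ᶠ (y zero *ᶠ e +ᶠ V.tail y ∙ v) ≈ c +ᶠ V.tail y ∙ v +ᶠ e *ᶠ y zero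
    rearrange v e = ≈-trans (+-congˡ (+-comm _ _)) (≈-trans (≈-sym (+-assoc _ _ _)) (+-congˡ (*-comm _ _)))

  count-affine-nonzero : ∀ K c (y : Vector Carrier (suc K)) → NonzeroVector y →
    sumOver (vectors (suc K)) (λ v → [≉0] (c +ᶠ y ∙ v)) ≡ q′ * q ^ K
  count-affine-nonzero zero c y y≢0 = count-affine-nonzero-head zero c y (λ y₀≈0 → y≢0 (λ { zero → y₀≈0 }))
  count-affine-nonzero (suc K) c y y≢0 with y zero ≟ 0#
  ... | no  y₀≉0 = count-affine-nonzero-head (suc K) c y y₀≉0
  ... | yes y₀≈0 = begin
    sumOver (vectors (suc (suc K))) (λ v → [≉0] (c +ᶠ y ∙ v))
      ≡⟨ sumOver-vectors-suc (suc K) _ ⟩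
    sum (λ i → sumOver (vectors (suc K)) (λ v → [≉0] (c +ᶠ (y zero *ᶠ enum i +ᶠ V.tail y ∙ v))))
      ≡⟨ sum-cong-≗ (λ i → trans (sumOver-cong (vectors (suc K)) (λ v → [≉0]-cong (drop-head v (enum i))))
                                 (count-affine-nonzero K c (V.tail y) tail-y≢0)) ⟩
    sum {q} (λ _ → q′ * q ^ K)
      ≡⟨ sum-const q _ ⟩
    q * (q′ * q ^ K)
      ≡⟨ rearrange q q′ (q ^ K) ⟩
    q′ * q ^ suc K ∎
    where
    open ≡-Reasoning
    drop-head : ∀ v e → c +ᶠ (y zero *ᶠ e +ᶠ V.tail y ∙ v) ≈ c +ᶠ V.tail y ∙ v
    drop-head v e = +-congˡ (≈-trans (+-congʳ (≈-trans (*-congʳ y₀≈0) (zeroˡ e))) (+-identityˡ _))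
    tail-y≢0 : NonzeroVector (V.tail y)
    tail-y≢0 tail-y≈0 = y≢0 (λ { zero → y₀≈0 ; (suc j) → tail-y≈0 j })
    rearrange : ∀ q q′ p → q * (q′ * p) ≡ q′ * (q * p)
    rearrange = solve-∀

  affinePoints : ∀ K → List (Vector Carrier (suc K))
  affinePoints K = map (1# V.∷_) (vectors K)

  atInfinity : ∀ {K} → List (Vector Carrier K) → List (Vector Carrier (suc K))
  atInfinity = map (0# V.∷_)

  multiplicity : ℕ → ℕ → ℕ
  multiplicity K d = ⌈ d / q ^ K ⌉

  residualDistance : ℕ → ℕ → ℕ
  residualDistance K d = d ∸ multiplicity K d * q′ * q ^ pred K

  doubledPart : ∀ k → ℕ → List (Vector Carrier k)
  doubledPart zero    d = []
  doubledPart (suc K) d = affinePoints K ++ atInfinity (doubledPart K (residualDistance K d))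

  sparePart : ∀ k → ℕ → List (Vector Carrier k)
  sparePart zero    d = []
  sparePart (suc K) d = concat (replicate (multiplicity K d ∸ 2) (affinePoints K))
                     ++ atInfinity (sparePart K (residualDistance K d))

  -- doubledPart twice followed by sparePart ⊆ doubledPart makes every column occur at least twice;
  -- altogether the affine points occur multiplicity K d times.
  code : ∀ k → ℕ → List (Vector Carrier k)
  code k d = doubledPart k d ++ doubledPart k d ++ sparePart k d

  sumOver-code : ∀ K d f → 2 ≤ multiplicity K d →
    sumOver (code (suc K) d) f
      ≡ multiplicity K d * sumOver (affinePoints K) f + sumOver (code K (residualDistance K d)) (λ v → f (0# V.∷ v))
  sumOver-code K d f 2≤s = begin
    sumOver (P ++ P ++ R) f                      ≡⟨ sumOver-++ P _ f ⟩
    sumOver P f + sumOver (P ++ R) f             ≡⟨ cong (sumOver P f +_) (sumOver-++ P R f) ⟩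
    sumOver P f + (sumOver P f + sumOver R f)    ≡⟨ cong₂ (λ a b → a + (a + b)) sumOver-P sumOver-R ⟩
    (A + p) + ((A + p) + ((s ∸ 2) * A + r))      ≡⟨ rearrange A p r (s ∸ 2) ⟩
    (s ∸ 2 + 2) * A + (p + (p + r))              ≡⟨ cong (λ t → t * A + (p + (p + r))) (ℕ.m∸n+n≡m 2≤s) ⟩
    s * A + (p + (p + r))                        ≡⟨ cong (s * A +_) sumOver-code′ ⟨
    s * A + sumOver (code K d′) f′               ∎
    where
    open ≡-Reasoning
    s d′ : ℕ
    s = multiplicity K d
    d′ = residualDistance K d
    f′ : Vector Carrier K → ℕ
    f′ v = f (0# V.∷ v)
    P R : List (Vector Carrier (suc K))
    P = doubledPart (suc K) d
    R = sparePart (suc K) d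
    A p r : ℕ
    A = sumOver (affinePoints K) f
    p = sumOver (doubledPart K d′) f′
    r = sumOver (sparePart K d′) f′
    sumOver-P : sumOver P f ≡ A + p
    sumOver-P = trans (sumOver-++ (affinePoints K) _ f)
                      (cong (A +_) (sumOver-map (0# V.∷_) (doubledPart K d′) f))
    sumOver-R : sumOver R f ≡ (s ∸ 2) * A + r
    sumOver-R = trans (sumOver-++ (concat (replicate (s ∸ 2) (affinePoints K))) _ f)
                      (cong₂ _+_ (sumOver-copies (s ∸ 2) (affinePoints K) f)
                                 (sumOver-map (0# V.∷_) (sparePart K d′) f))
    sumOver-code′ : sumOver (code K d′) f′ ≡ p + (p + r)
    sumOver-code′ = trans (sumOver-++ (doubledPart K d′) _ f′)
                          (cong (p +_) (sumOver-++ (doubledPart K d′) _ f′))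
    rearrange : ∀ A p r t → (A + p) + ((A + p) + (t * A + r)) ≡ (t + 2) * A + (p + (p + r))
    rearrange = solve-∀

  weight-affinePoints-tail≈0 : ∀ K (x : Vector Carrier (suc K)) → x zero ≉ 0# → (∀ i → V.tail x i ≈ 0#) →
    weight (affinePoints K) x ≡ q ^ K
  weight-affinePoints-tail≈0 K x x₀≉0 tail≈0 = begin
    weight (affinePoints K) x
      ≡⟨ sumOver-map (1# V.∷_) (vectors K) _ ⟩
    sumOver (vectors K) (λ v → [≉0] (x zero *ᶠ 1# +ᶠ V.tail x ∙ v))
      ≡⟨ sumOver-cong (vectors K) (λ v → [≉0]-≉0 (x₀≉0 ∘ ≈-trans (≈-sym (value≈x₀ v)))) ⟩
    sumOver (vectors K) (λ _ → 1)
      ≡⟨ trans (sumOver-vectors-const K 1) (ℕ.*-identityʳ (q ^ K)) ⟩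
    q ^ K ∎
    where
    open ≡-Reasoning
    value≈x₀ : ∀ v → x zero *ᶠ 1# +ᶠ V.tail x ∙ v ≈ x zero
    value≈x₀ v = ≈-trans (+-cong (*-identityʳ (x zero)) (∙-zeroˡ v tail≈0)) (+-identityʳ (x zero))

  weight-affinePoints-tail≉0 : ∀ K (x : Vector Carrier (suc (suc K))) → NonzeroVector (V.tail x) →
    weight (affinePoints (suc K)) x ≡ q′ * q ^ K
  weight-affinePoints-tail≉0 K x tail≢0 = trans (sumOver-map (1# V.∷_) (vectors (suc K)) _)
                                                (count-affine-nonzero K (x zero *ᶠ 1#) (V.tail x) tail≢0)

  weight-code : ∀ K d x → 2 ≤ multiplicity K d →
    weight (code (suc K) d) x
      ≡ multiplicity K d * weight (affinePoints K) x + weight (code K (residualDistance K d)) (V.tail x)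
  weight-code K d x 2≤s = trans (sumOver-code K d _ 2≤s)
    (cong (multiplicity K d * weight (affinePoints K) x +_) (sumOver-cong (code K (residualDistance K d))
      (λ v → [≉0]-cong (≈-trans (+-congʳ (zeroʳ (x zero))) (+-identityˡ _)))))

  length-code : ∀ K d → 2 ≤ multiplicity K d →
    length (code (suc K) d) ≡ multiplicity K d * q ^ K + length (code K (residualDistance K d))
  length-code K d 2≤s = begin
    length (code (suc K) d)
      ≡⟨ length≡sumOver-1 (code (suc K) d) ⟩
    sumOver (code (suc K) d) (λ _ → 1)
      ≡⟨ sumOver-code K d (λ _ → 1) 2≤s ⟩
    s * sumOver (affinePoints K) (λ _ → 1) + sumOver (code K d′) (λ _ → 1)
      ≡⟨ cong₂ (λ a b → s * a + b) length-affinePoints (sym (length≡sumOver-1 (code K d′))) ⟩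
    s * q ^ K + length (code K d′) ∎
    where
    open ≡-Reasoning
    length-affinePoints : sumOver (affinePoints K) (λ _ → 1) ≡ q ^ K
    length-affinePoints = trans (sumOver-map (1# V.∷_) (vectors K) _)
                                (trans (sumOver-vectors-const K 1) (ℕ.*-identityʳ _))
    s d′ : ℕ
    s = multiplicity K d
    d′ = residualDistance K d

  -- Large enough for 2 ≤ multiplicity and for residualDistance not to truncate, at every level of
  -- the recursion.
  threshold : ℕ → ℕ
  threshold K = (2 + K * q) * q ^ K

  threshold≤⇒multiplicity≥ : ∀ K d → threshold K ≤ d → 2 + K * q ≤ multiplicity K d
  threshold≤⇒multiplicity≥ K d h =
    *≤⇒≤⌈/⌉ (ℕ.m^n>0 q K) d _ (ℕ.≤-trans (ℕ.≤-reflexive (ℕ.*-comm (q ^ K) _)) h)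

  threshold≤⇒2≤multiplicity : ∀ K d → threshold K ≤ d → 2 ≤ multiplicity K d
  threshold≤⇒2≤multiplicity K d h = ℕ.≤-trans (ℕ.m≤m+n 2 _) (threshold≤⇒multiplicity≥ K d h)

  threshold-step : ∀ K d → threshold (suc K) ≤ d → multiplicity (suc K) d * q′ * q ^ K + threshold K ≤ d
  threshold-step K d h with multiplicity (suc K) d in s≡ | threshold≤⇒multiplicity≥ (suc K) d h
  ... | suc s₁ | s≤s s₁≥ = ℕ.≤-trans bound (ℕ.<⇒≤ (⌈/⌉≡suc⇒*< (ℕ.m^n>0 q (suc K)) d s₁ s≡))
    where
    open ℕ.≤-Reasoning
    p : ℕ
    p = q ^ K
    bound : suc s₁ * q′ * p + threshold K ≤ q ^ suc K * s₁
    bound = begin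
      suc s₁ * q′ * p + (2 + K * q) * p       ≡⟨ split s₁ q′ p (K * q) ⟩
      s₁ * q′ * p + (2 + (q′ + K * q)) * p   ≤⟨ ℕ.+-monoʳ-≤ (s₁ * q′ * p) (ℕ.*-monoˡ-≤ p s₁≥) ⟩
      s₁ * q′ * p + s₁ * p                   ≡⟨ merge s₁ q′ p ⟩
      suc q′ * p * s₁                        ∎
      where
      split : ∀ s₁ q′ p c → suc s₁ * q′ * p + (2 + c) * p ≡ s₁ * q′ * p + (2 + (q′ + c)) * p
      split = solve-∀
      merge : ∀ s₁ q′ p → s₁ * q′ * p + s₁ * p ≡ suc q′ * p * s₁
      merge = solve-∀

  threshold-residual : ∀ K d → threshold (suc K) ≤ d → threshold K ≤ residualDistance (suc K) d
  threshold-residual K d h = ℕ.m+n≤o⇒m≤o∸n (threshold K) {multiplicity (suc K) d * q′ * q ^ K}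
    (ℕ.≤-trans (ℕ.≤-reflexive (ℕ.+-comm (threshold K) _)) (threshold-step K d h))

  residualDistance+affine≡ : ∀ K d → threshold (suc K) ≤ d →
    residualDistance (suc K) d + multiplicity (suc K) d * q′ * q ^ K ≡ d
  residualDistance+affine≡ K d h =
    ℕ.m∸n+n≡m (ℕ.≤-trans (ℕ.m≤m+n (multiplicity (suc K) d * q′ * q ^ K) _) (threshold-step K d h))

  minWeight-tail≈0 : ∀ K d x → 2 ≤ multiplicity K d → x zero ≉ 0# → (∀ i → V.tail x i ≈ 0#) →
    d ≤ weight (code (suc K) d) x
  minWeight-tail≈0 K d x 2≤s x₀≉0 tail≈0 = begin
    d                                      ≤⟨ m≤b*⌈m/b⌉ (ℕ.m^n>0 q K) d ⟩
    q ^ K * s                              ≡⟨ ℕ.*-comm (q ^ K) s ⟩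
    s * q ^ K                              ≡⟨ cong (s *_) (weight-affinePoints-tail≈0 K x x₀≉0 tail≈0) ⟨
    s * weight (affinePoints K) x          ≤⟨ ℕ.m≤m+n _ _ ⟩
    s * weight (affinePoints K) x + _      ≡⟨ weight-code K d x 2≤s ⟨
    weight (code (suc K) d) x              ∎
    where
    open ℕ.≤-Reasoning
    s : ℕ
    s = multiplicity K d

  code-minWeight : ∀ K d → threshold K ≤ d → MinWeight (code (suc K) d) d
  code-minWeight zero d large x x≢0 = minWeight-tail≈0 zero d x (threshold≤⇒2≤multiplicity zero d large)
                                                      (λ x₀≈0 → x≢0 (λ { zero → x₀≈0 })) (λ ())
  code-minWeight (suc K) d large x x≢0 with all? (λ i → V.tail x i ≟ 0#)
  ... | yes tail≈0 = minWeight-tail≈0 (suc K) d x (threshold≤⇒2≤multiplicity (suc K) d large)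
                                      (λ x₀≈0 → x≢0 (λ { zero → x₀≈0 ; (suc i) → tail≈0 i })) tail≈0
  ... | no tail≢0 = begin
    d                                        ≡⟨ residualDistance+affine≡ K d large ⟨
    d′ + s * q′ * q ^ K                      ≤⟨ ℕ.+-mono-≤ residual-minWeight (ℕ.≤-reflexive (ℕ.*-assoc s q′ _)) ⟩
    W + s * (q′ * q ^ K)                     ≡⟨ cong (λ a → W + s * a) (weight-affinePoints-tail≉0 K x tail≢0) ⟨
    W + s * weight (affinePoints (suc K)) x  ≡⟨ ℕ.+-comm W _ ⟩
    s * weight (affinePoints (suc K)) x + W  ≡⟨ weight-code (suc K) d x 2≤s ⟨
    weight (code (suc (suc K)) d) x          ∎
    where
    open ℕ.≤-Reasoning
    s d′ W : ℕ
    s = multiplicity (suc K) d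
    d′ = residualDistance (suc K) d
    W = weight (code (suc K) d′) (V.tail x)
    2≤s : 2 ≤ s
    2≤s = threshold≤⇒2≤multiplicity (suc K) d large
    residual-minWeight : d′ ≤ W
    residual-minWeight = code-minWeight K d′ (threshold-residual K d large) (V.tail x) tail≢0

  code-length : ∀ K d → threshold K ≤ d → length (code (suc K) d) ≡ griesmer q (suc K) d
  code-length zero d large =
    trans (length-code zero d (threshold≤⇒2≤multiplicity zero d large)) (cong (_+ 0) (ℕ.*-identityʳ _))
  code-length (suc K) d large = begin
    length (code (suc (suc K)) d)
      ≡⟨ length-code (suc K) d (threshold≤⇒2≤multiplicity (suc K) d large) ⟩
    s * q ^ suc K + length (code (suc K) d′)
      ≡⟨ cong₂ (λ a b → s * a + b) (sym (suc[q-1]*repunit≡q^ q′ (suc K)))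
                                  (code-length K d′ (threshold-residual K d large)) ⟩
    s * suc (q′ * repunit q (suc K)) + griesmer q (suc K) d′
      ≡⟨ rearrange s q′ (repunit q (suc K)) _ ⟩
    griesmer q (suc K) d′ + s * q′ * repunit q (suc K) + s
      ≡⟨ cong (_+ s) (griesmerFrom-+* K 0 d′ (s * q′)) ⟨
    griesmer q (suc K) (d′ + s * q′ * q ^ K) + s
      ≡⟨ cong (λ e → griesmer q (suc K) e + s) (residualDistance+affine≡ K d large) ⟩
    griesmer q (suc K) d + s
      ≡⟨ griesmerFrom-snoc (suc K) 0 d ⟨
    griesmer q (suc (suc K)) d ∎
    where
    open ≡-Reasoning
    s d′ : ℕ
    s = multiplicity (suc K) d
    d′ = residualDistance (suc K) d
    rearrange : ∀ s q′ r g → s * suc (q′ * r) + g ≡ g + s * q′ * r + s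
    rearrange = solve-∀

  sparePart⊆doubledPart : ∀ k d → sparePart k d ⊆ doubledPart k d
  sparePart⊆doubledPart zero    d ()
  sparePart⊆doubledPart (suc K) d = ⊆.++⁺ (concat-replicate⊆ (multiplicity K d ∸ 2) (affinePoints K))
                                          (⊆.map⁺ (0# V.∷_) (sparePart⊆doubledPart K (residualDistance K d)))

  code-repeated : ∀ k d → Repeated (code k d)
  code-repeated k d =
    repeated-++ (⊆.xs⊆xs++ys P R) (λ x∈P++R → [ id , sparePart⊆doubledPart k d ]′ (∈-++⁻ P x∈P++R))
    where
    P R : List (Vector Carrier k)
    P = doubledPart k d
    R = sparePart k d

module GeneratorMatrices {q′ : ℕ} (F : FiniteField (suc q′)) where

  open FiniteField F hiding (zero)
    renaming (_+_ to _+ᶠ_; _*_ to _*ᶠ_; -_ to -ᶠ_; refl to ≈-refl; sym to ≈-sym; trans to ≈-trans)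
  open Codes F using (GenMatrix; encode; hamming; FullRank; MinDist≥; Locality; IsLRC)
  open FieldLemmas F
  open DotProduct F
  open Weights F

  columns : ∀ {k n} → GenMatrix k n → List (Vector Carrier k)
  columns {n = zero}  G = []
  columns {n = suc n} G = (λ i → G i zero) ∷ columns (λ i j → G i (suc j))

  length-columns : ∀ {k n} (G : GenMatrix k n) → length (columns G) ≡ n
  length-columns {n = zero}  G = refl
  length-columns {n = suc n} G = cong suc (length-columns (λ i j → G i (suc j)))

  generator : ∀ {k} (C : List (Vector Carrier k)) → GenMatrix k (length C)
  generator C i j = lookup C j i

  columns-generator : ∀ {k} (C : List (Vector Carrier k)) → columns (generator C) ≡ C
  columns-generator []      = refl
  columns-generator (v ∷ C) = cong (v ∷_) (columns-generator C)

  hamming-encode : ∀ {k n} (G : GenMatrix k n) x y →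
    hamming (encode G x) (encode G y) ≡ weight (columns G) (x +ᵛ -ᶠ 1# · y)
  hamming-encode {n = zero}  G x y = refl
  hamming-encode {n = suc n} G x y with encode G x zero ≟ encode G y zero
  ... | yes same  = cong₂ _+_ (sym ([≉0]-≈0 (≈-trans (∙-+ᵛ· x y (-ᶠ 1#) _) (x≈y⇒x+-1*y≈0 same))))
                             (hamming-encode (λ i j → G i (suc j)) x y)
  ... | no differ = cong₂ _+_ (sym ([≉0]-≉0 (differ ∘ x+-1*y≈0⇒x≈y ∘ ≈-trans (≈-sym (∙-+ᵛ· x y (-ᶠ 1#) _)))))
                             (hamming-encode (λ i j → G i (suc j)) x y)

  weight-columns-≡0 : ∀ {k n} (G : GenMatrix k n) x → (∀ j → encode G x j ≈ 0#) → weight (columns G) x ≡ 0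
  weight-columns-≡0 {n = zero}  G x encode≈0 = refl
  weight-columns-≡0 {n = suc n} G x encode≈0 =
    cong₂ _+_ ([≉0]-≈0 (encode≈0 zero))
              (weight-columns-≡0 (λ i j → G i (suc j)) x (λ j → encode≈0 (suc j)))

  minWeight⇒fullRank : ∀ {k n} (G : GenMatrix k n) {d} → 0 < d → MinWeight (columns G) d → FullRank G
  minWeight⇒fullRank G {d} d>0 minWeight x encode≈0 i with x i ≟ 0#
  ... | yes xᵢ≈0 = xᵢ≈0
  ... | no  xᵢ≉0 = contradiction (ℕ.<-≤-trans d>0 d≤0) (ℕ.n≮n 0)
    where
    d≤0 : d ≤ 0
    d≤0 = subst (d ≤_) (weight-columns-≡0 G x encode≈0) (minWeight x (λ x≈0 → xᵢ≉0 (x≈0 i)))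

  minWeight⇒minDist : ∀ {k n} (G : GenMatrix k n) {d} → MinWeight (columns G) d → MinDist≥ G d
  minWeight⇒minDist G {d} minWeight x y encodings≉ =
    subst (d ≤_) (sym (hamming-encode G x y)) (minWeight (x +ᵛ -ᶠ 1# · y) x-y≢0)
    where
    x-y≢0 : NonzeroVector (x +ᵛ -ᶠ 1# · y)
    x-y≢0 x-y≈0 = encodings≉ (λ j → ∙-congˡ (λ i → G i j) (λ i → x+-1*y≈0⇒x≈y (x-y≈0 i)))

  isLRC⇒minWeight : ∀ {k n} (G : GenMatrix k n) {d r} → IsLRC G d r → MinWeight (columns G) d
  isLRC⇒minWeight G {d} (fullRank , minDist , _) x x≢0 =
    subst (d ≤_) (trans (hamming-encode G x 0ᵛ) (weight-cong (columns G) x-0≈x)) (minDist x 0ᵛ encodings≉)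
    where
    0ᵛ : Vector Carrier _
    0ᵛ _ = 0#
    x-0≈x : ∀ i → x i +ᶠ -ᶠ 1# *ᶠ 0# ≈ x i
    x-0≈x i = ≈-trans (+-congˡ (zeroʳ (-ᶠ 1#))) (+-identityʳ (x i))
    encodings≉ : ¬ (∀ j → encode G x j ≈ encode G 0ᵛ j)
    encodings≉ same = x≢0 (fullRank x (λ j → ≈-trans (same j) (∙-zeroˡ (λ i → G i j) (λ _ → ≈-refl))))

  repeated⇒locality : ∀ {k} (C : List (Vector Carrier k)) {r} → 1 ≤ r → Repeated C → Locality (generator C) r
  repeated⇒locality C {r} 1≤r repeated i with repeated i
  ... | j , j≢i , same =
    ⁅ j ⁆ , (λ i∈⁅j⁆ → j≢i (sym (x∈⁅y⁆⇒x≡y j i∈⁅j⁆))) , subst (_≤ r) (sym (∣⁅x⁆∣≡1 j)) 1≤r ,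
    λ x y agree → subst (λ v → x ∙ v ≈ y ∙ v) same (agree j (x∈⁅x⁆ j))

module LocallyRepairableGriesmerCodes {q′ : ℕ} (F : FiniteField (suc q′)) where

  open Codes F using (GenMatrix; IsLRC; nq≡)
  open Weights F using (MinWeight)
  open GriesmerBound F using (griesmer-bound)
  open Construction F using (code; threshold; code-minWeight; code-length; code-repeated)
  open GeneratorMatrices F

  private
    q : ℕ
    q = suc q′

  isLRC⇒griesmer≤ : ∀ {k n} (G : GenMatrix k n) {d r} → IsLRC G d r → griesmer q k d ≤ n
  isLRC⇒griesmer≤ {k} G {d} lrc =
    subst (griesmer q k d ≤_) (length-columns G) (griesmer-bound k (columns G) d (isLRC⇒minWeight G lrc))

  code-isLRC : ∀ K d r → 1 ≤ r → threshold K ≤ d → IsLRC (generator (code (suc K) d)) d r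
  code-isLRC K d r 1≤r large =
    minWeight⇒fullRank G d>0 minWeight ,
    minWeight⇒minDist G minWeight ,
    repeated⇒locality C 1≤r (code-repeated (suc K) d)
    where
    C : List (Vector _ (suc K))
    C = code (suc K) d
    G : GenMatrix (suc K) (length C)
    G = generator C
    minWeight : MinWeight (columns G) d
    minWeight = subst (λ L → MinWeight L d) (sym (columns-generator C)) (code-minWeight K d large)
    d>0 : 0 < d
    d>0 = ℕ.<-≤-trans (ℕ.<-≤-trans (ℕ.m^n>0 q K) (ℕ.m≤m+n (q ^ K) _)) large

  nq≡griesmer : ∀ K d r → 1 ≤ r → threshold K ≤ d → nq≡ (suc K) d r (griesmer q (suc K) d)
  nq≡griesmer K d r 1≤r large =
    subst (λ n → Σ (GenMatrix (suc K) n) (λ G → IsLRC G d r)) (code-length K d large)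
          (generator (code (suc K) d) , code-isLRC K d r 1≤r large) ,
    λ n G lrc → isLRC⇒griesmer≤ G lrc

-- Primality of q is only needed for F to exist, and 2 ≤ k only to exclude k = 0.
theorem10 : ∀ (q : ℕ) → IsPrimePower q → (F : FiniteField q) →
    ∀ (k r : ℕ) → 2 ≤ k → 1 ≤ r →
    ∃[ D ] (∀ (d : ℕ) → D ≤ d → Codes.nq≡ F k d r (griesmer q k d))
theorem10 zero     _ F _       _ _  _   with FiniteField.enum-surj F (FiniteField.0# F)
... | () , _
theorem10 (suc q′) _ F zero    _ () _
theorem10 (suc q′) _ F (suc K) r _  1≤r =
  Construction.threshold F K , λ d large → LocallyRepairableGriesmerCodes.nq≡griesmer F K d r 1≤r large
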